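{- Let $G=(V,E)$ be a graph, $p\colon V\to\mathbb{Z}_{>0}$, and $\prec$ a total order on $V$. Then $\mathcal P(G,p)$ is full-dimensional, i.e., $\dim(\mathcal P(G,p))=n+\bar e-|S|+1$.
   Context: $n=|V|$, $\bar E$ is the edge set of the complement of $G$ and $\bar e=|\bar E|$. Let $\bar N^-(v)=\{u\in V: u\prec v,\ \{u,v\}\notin E\}$, $\bar N^+(v)=\{u\in V: v\prec u,\ \{u,v\}\notin E\}$, $\bar N^-[v]=\bar N^-(v)\cup\{v\}$, $S=\{v:\bar N^-(v)=\emptyset\}$, $T=\{v:\bar N^+(v)=\emptyset\}$. Variables: $x_{uv}$ for $v\in V$, $u\in\bar N^-(v)$, and $x_{vv}$ for $v\in V\setminus S$ (so $n+\bar e-|S|$ variables), plus a real variable $y$. $\mathcal K(v)$ is the collection of subsets of $\bar N^+(v)$ inducing a clique of size 2 in $G$ or a maximal clique of size 1 in $G[\bar N^+(v)]$. Constraints: (C1) $\sum_{u\in\bar N^-[v]}x_{uv}\ge1$ for $v\in V\setminus S$; (C2) $\sum_{u\in K}x_{vu}\le x_{vv}$ for $v\in(V\setminus T)\setminus S$, $K\in\mathcal K(v)$; (C3) $\sum_{u\in K}x_{vu}\le 1$ for $v\in(V\setminus T)\cap S$, $K\in\mathcal K(v)$; (C4) $p(v)x_{vv}+\sum_{u\in\bar N^+(v)}p(u)x_{vu}\le y$ for $v\in V\setminus S$; (C5) $p(v)+\sum_{u\in\bar N^+(v)}p(u)x_{vu}\le y$ for $v\in S$. $\mathcal P(G,p)=\operatorname{conv}\{(y,x)\in\mathbb{R}_{\ge0}\times\{0,1\}^{n+\bar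 e-|S|}:(y,x)\text{ satisfies (C1)–(C5)}\}$. -}

module Defs where

open import Level using (0ℓ)
open import Data.Nat as ℕ using (ℕ; zero; suc)
open import Data.Integer using (+_)
open import Data.Rational using (ℚ; 0ℚ; 1ℚ; _+_; _*_; _≤_; _/_)
open import Data.Fin using (Fin)
open import Data.Fin.Properties using (any?)
open import Data.List using (List; []; _∷_; length; filter; allFin; map; foldr)
open import Data.Product using (_×_; Σ; ∃; _,_)
open import Data.Sum using (_⊎_)
open import Data.Bool using (if_then_else_)
open import Relation.Nullary using (¬_; Dec; does; ¬?; _×-dec_; _⊎-dec_)
open import Relation.Binary using (Rel; Decidable; IsStrictTotalOrder)
open import Relation.Binary.PropositionalEquality using (_≡_; _≢_)
import Data.Fin.Properties as FinP

ℕ→ℚ : ℕ → ℚ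
ℕ→ℚ k = (+ k) / 1

Σℚ : ∀ {k} → (Fin k → ℚ) → ℚ
Σℚ {zero}  f = 0ℚ
Σℚ {suc k} f = f Fin.zero + Σℚ (λ i → f (Fin.suc i))

sumℚ : List ℚ → ℚ
sumℚ = foldr _+_ 0ℚ

count : ∀ {n} {P : Fin n → Set} → (∀ v → Dec (P v)) → ℕ
count P? = length (filter P? (allFin _))

-- A point of the ambient space: a real (here rational) coordinate y and
-- coordinates x u v; only the coordinates (u,v) with Var u v (see below)
-- are meaningful, the others are ignored everywhere.
record Point (n : ℕ) : Set where
  constructor ⟨_,_⟩
  field
    y : ℚ
    x : Fin n → Fin n → ℚ
open Point public

module Setup {n : ℕ}
  (Adj : Rel (Fin n) 0ℓ) (adj? : Decidable Adj)
  (_≺_ : Rel (Fin n) 0ℓ) (≺-sto : IsStrictTotalOrder _≡_ _≺_)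
  (p : Fin n → ℕ) where

  open IsStrictTotalOrder ≺-sto using (_<?_)

  InNm : Fin n → Fin n → Set
  InNm u v = (u ≺ v) × ¬ Adj u v

  inNm? : ∀ u v → Dec (InNm u v)
  inNm? u v = (u <? v) ×-dec ¬? (adj? u v)

  InNp : Fin n → Fin n → Set
  InNp v u = (v ≺ u) × ¬ Adj v u

  inNp? : ∀ v u → Dec (InNp v u)
  inNp? v u = (v <? u) ×-dec ¬? (adj? v u)

  InNmc : Fin n → Fin n → Set
  InNmc u v = (u ≡ v) ⊎ InNm u v

  inNmc? : ∀ u v → Dec (InNmc u v)
  inNmc? u v = (u FinP.≟ v) ⊎-dec inNm? u v

  InS : Fin n → Set
  InS v = ¬ ∃ (λ u → InNm u v)

  inS? : ∀ v → Dec (InS v)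
  inS? v = ¬? (any? (λ u → inNm? u v))

  InT : Fin n → Set
  InT v = ¬ ∃ (λ u → InNp v u)

  cardS : ℕ
  cardS = count inS?

  -- ē = number of edges of the complement of G (each unordered non-adjacent
  -- pair {u,v} with u ≠ v counted once, via its ≺-smaller endpoint)
  ebar : ℕ
  ebar = foldr ℕ._+_ 0 (map (λ v → count (λ u → inNm? u v)) (allFin n))

  nvars : ℕ
  nvars = (n ℕ.+ ebar) ℕ.∸ cardS

  Var : Fin n → Fin n → Set
  Var u v = ((u ≡ v) × ¬ InS v) ⊎ InNm u v

  Σ[_]_ : {P : Fin n → Set} → (∀ u → Dec (P u)) → (Fin n → ℚ) → ℚ
  Σ[ P? ] f = Σℚ (λ u → if does (P? u) then f u else 0ℚ)

  -- 𝒦(v): a 2-clique {a,b} ⊆ N̄⁺(v) of G, or a singleton {a} ⊆ N̄⁺(v)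
  -- which is a maximal clique of G[N̄⁺(v)] (a listed as a list of vertices)
  data 𝒦 (v : Fin n) : List (Fin n) → Set where
    pair   : ∀ a b → InNp v a → InNp v b → a ≢ b → Adj a b →
             𝒦 v (a ∷ b ∷ [])
    single : ∀ a → InNp v a → (∀ b → InNp v b → ¬ Adj a b) →
             𝒦 v (a ∷ [])

  record Feasible (q : Point n) : Set where
    field
      y≥0    : 0ℚ ≤ y q
      binary : ∀ u v → Var u v → (x q u v ≡ 0ℚ) ⊎ (x q u v ≡ 1ℚ)
      C1 : ∀ v → ¬ InS v → 1ℚ ≤ Σ[ (λ u → inNmc? u v) ] (λ u → x q u v)
      C2 : ∀ v → ¬ InT v → ¬ InS v → ∀ K → 𝒦 v K →
           sumℚ (map (x q v) K) ≤ x q v v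
      C3 : ∀ v → ¬ InT v → InS v → ∀ K → 𝒦 v K →
           sumℚ (map (x q v) K) ≤ 1ℚ
      C4 : ∀ v → ¬ InS v →
           ℕ→ℚ (p v) * x q v v
             + Σ[ inNp? v ] (λ u → ℕ→ℚ (p u) * x q v u) ≤ y q
      C5 : ∀ v → InS v →
           ℕ→ℚ (p v) + Σ[ inNp? v ] (λ u → ℕ→ℚ (p u) * x q v u) ≤ y q

  -- membership in 𝒫(G,p) = conv of the feasible points
  -- (convex combinations with rational coefficients; only the
  --  coordinates y and x_{uv} with Var u v are compared)
  In𝒫 : Point n → Set
  In𝒫 q = Σ ℕ λ m → Σ (Fin m → Point n) λ pts → Σ (Fin m → ℚ) λ w →
            (∀ i → Feasible (pts i)) × (∀ i → 0ℚ ≤ w i) ×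
            (Σℚ w ≡ 1ℚ) ×
            (y q ≡ Σℚ (λ i → w i * y (pts i))) ×
            (∀ u v → Var u v → x q u v ≡ Σℚ (λ i → w i * x (pts i) u v))

  AffinelyIndependent : ∀ {k} → (Fin k → Point n) → Set
  AffinelyIndependent {k} pts =
    ∀ (λ' : Fin k → ℚ) →
      Σℚ λ' ≡ 0ℚ →
      Σℚ (λ i → λ' i * y (pts i)) ≡ 0ℚ →
      (∀ u v → Var u v → Σℚ (λ i → λ' i * x (pts i) u v) ≡ 0ℚ) →
      ∀ i → λ' i ≡ 0ℚ

  -- 𝒫(G,p) ⊆ ℝ^{1 + nvars} is full-dimensional, i.e. has dimension
  -- nvars + 1: it contains nvars + 2 affinely independent points
  FullDimensional : Set
  FullDimensional = Σ (Fin (suc (suc nvars)) → Point n) λ pts →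
                      (∀ i → In𝒫 (pts i)) × AffinelyIndependent pts

-- Every point used is a 0/1 point with a large y.  With M = 2 Σ p the
-- knapsack constraints (C4), (C5) hold automatically, and (C1)–(C3) hold for
-- any 0/1 matrix x whose columns are covered within N̄⁻[v] and whose rows
-- carry at most one off-diagonal one, which then forces x_vv = 1.  Take the
-- identity matrix at heights M and M + 1, and for every variable one matrix
-- at height M: for x_uv (u ∈ N̄⁻(v)) the identity plus the entry (u,v); for
-- x_vv (v ∉ S) the identity with the one of column v moved to a row
-- u ∈ N̄⁻(v).  Affine independence is triangular: the y coordinate isolates
-- the second identity point, x_vv the point of x_vv, and then x_uv (once the
-- diagonal coefficients are known to vanish) the point of x_uv.
module Submission where

open import Defs
open import Level using (0ℓ)
open import Data.Nat as ℕ using (ℕ; zero; suc; _<_)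
import Data.Nat.Properties as ℕ
open import Data.Fin using (Fin; zero; suc)
open import Data.Fin.Properties using (any?; suc-injective) renaming (_≟_ to _≟ᶠ_)
open import Data.Rational using (ℚ; 0ℚ; 1ℚ; _+_; _*_; _-_; _≤_; 1/_; ≢-nonZero)
open import Data.Rational.Properties
open import Data.Rational.Solver using (module +-*-Solver)
open import Data.Bool using (Bool; true; false; T; not; _∧_; _∨_; if_then_else_)
open import Data.List using (List; []; _∷_; map; filter; allFin; length; concat; _++_; foldr; lookup)
open import Data.List.Properties using (length-map; length-++; length-tabulate; length-filter)
open import Data.List.Relation.Unary.All as All using (All)
import Data.List.Relation.Unary.All.Properties as All
open import Data.List.Relation.Unary.AllPairs as AllPairs using ()
import Data.List.Relation.Unary.AllPairs.Properties as AllPairs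
open import Data.List.Relation.Unary.Unique.Propositional using (Unique; []; _∷_)
import Data.List.Relation.Unary.Unique.Propositional.Properties as Unique
open import Data.List.Membership.Propositional using (_∈_)
open import Data.List.Membership.Propositional.Properties
  using (∈-map⁻; ∈-filter⁻; ∈-concat⁻′; ∈-++⁻; ∈-lookup)
open import Data.Product using (Σ; ∃; _×_; _,_; proj₁; proj₂)
open import Data.Sum using (_⊎_; inj₁; inj₂; [_,_])
open import Data.Empty using (⊥; ⊥-elim)
open import Function.Definitions using (Injective)
open import Relation.Nullary using (¬_; Dec; yes; no; does; ¬?)
open import Relation.Nullary.Decidable using (dec-true)
open import Relation.Binary using (Rel; Decidable; Symmetric; IsStrictTotalOrder)
open import Relation.Binary.PropositionalEquality hiding ([_])
open import Function using (_∘′_)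

Σℚ-zero : ∀ {k} (f : Fin k → ℚ) → (∀ i → f i ≡ 0ℚ) → Σℚ f ≡ 0ℚ
Σℚ-zero {zero}  f f≡0 = refl
Σℚ-zero {suc k} f f≡0 =
  trans (cong₂ _+_ (f≡0 zero) (Σℚ-zero (λ i → f (suc i)) (λ i → f≡0 (suc i)))) (+-identityʳ 0ℚ)

Σℚ-single : ∀ {k} (f : Fin k → ℚ) j → (∀ i → i ≢ j → f i ≡ 0ℚ) → Σℚ f ≡ f j
Σℚ-single {suc k} f zero others =
  trans (cong (f zero +_) (Σℚ-zero _ (λ i → others (suc i) λ ()))) (+-identityʳ _)
Σℚ-single {suc k} f (suc j) others =
  trans (cong₂ _+_ (others zero λ ())
                    (Σℚ-single (λ i → f (suc i)) j (λ i i≢j → others (suc i) (i≢j ∘′ suc-injective))))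
        (+-identityˡ _)

Σℚ-mono : ∀ {k} {f g : Fin k → ℚ} → (∀ i → f i ≤ g i) → Σℚ f ≤ Σℚ g
Σℚ-mono {zero}  f≤g = ≤-refl
Σℚ-mono {suc k} f≤g = +-mono-≤ (f≤g zero) (Σℚ-mono (λ i → f≤g (suc i)))

Σℚ-nonneg : ∀ {k} {f : Fin k → ℚ} → (∀ i → 0ℚ ≤ f i) → 0ℚ ≤ Σℚ f
Σℚ-nonneg {k} 0≤f = ≤-trans (≤-reflexive (sym (Σℚ-zero {k} (λ _ → 0ℚ) (λ _ → refl)))) (Σℚ-mono 0≤f)

p≤p+q : ∀ {p q} → 0ℚ ≤ q → p ≤ p + q
p≤p+q {p} 0≤q = ≤-trans (≤-reflexive (sym (+-identityʳ p))) (+-monoʳ-≤ p 0≤q)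

p≤q+p : ∀ {p q} → 0ℚ ≤ q → p ≤ q + p
p≤q+p {p} {q} 0≤q = ≤-trans (p≤p+q 0≤q) (≤-reflexive (+-comm p q))

term≤Σℚ : ∀ {k} (f : Fin k → ℚ) → (∀ i → 0ℚ ≤ f i) → ∀ j → f j ≤ Σℚ f
term≤Σℚ f 0≤f zero    = p≤p+q (Σℚ-nonneg (λ i → 0≤f (suc i)))
term≤Σℚ f 0≤f (suc j) = ≤-trans (term≤Σℚ (λ i → f (suc i)) (λ i → 0≤f (suc i)) j) (p≤q+p (0≤f zero))

Σℚ-affine : ∀ {k} (a f : Fin k → ℚ) c →
            Σℚ (λ i → a i * (f i - c)) ≡ Σℚ (λ i → a i * f i) - Σℚ a * c
Σℚ-affine {zero}  a f c = sym (cong (0ℚ -_) (*-zeroˡ c))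
Σℚ-affine {suc k} a f c = begin
  a zero * (f zero - c) + Σℚ (λ i → a (suc i) * (f (suc i) - c))
    ≡⟨ cong (a zero * (f zero - c) +_) (Σℚ-affine (λ i → a (suc i)) (λ i → f (suc i)) c) ⟩
  a zero * (f zero - c) + (Σℚ (λ i → a (suc i) * f (suc i)) - Σℚ (λ i → a (suc i)) * c)
    ≡⟨ regroup (a zero) (f zero) c _ _ ⟩
  (a zero * f zero + Σℚ (λ i → a (suc i) * f (suc i))) - (a zero + Σℚ (λ i → a (suc i))) * c ∎
  where
  open ≡-Reasoning
  open +-*-Solver
  regroup : ∀ a f c X A → a * (f - c) + (X - A * c) ≡ (a * f + X) - (a + A) * c
  regroup = solve 5 (λ a f c X A → a :* (f :- c) :+ (X :- A :* c) := (a :* f :+ X) :- (a :+ A) :* c) refl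

p*q≡0⇒p≡0 : ∀ p q → q ≢ 0ℚ → p * q ≡ 0ℚ → p ≡ 0ℚ
p*q≡0⇒p≡0 p q q≢0 pq≡0 = begin
  p               ≡⟨ sym (*-identityʳ p) ⟩
  p * 1ℚ          ≡⟨ cong (p *_) (sym (*-inverseʳ q)) ⟩
  p * (q * 1/ q)  ≡⟨ sym (*-assoc p q (1/ q)) ⟩
  (p * q) * 1/ q  ≡⟨ cong (_* 1/ q) pq≡0 ⟩
  0ℚ * 1/ q       ≡⟨ *-zeroˡ (1/ q) ⟩
  0ℚ              ∎
  where
  open ≡-Reasoning
  instance q≢0′ = ≢-nonZero q≢0

isolated-coefficient≡0 : ∀ {k} (λ′ f : Fin k → ℚ) c (j : Fin k) →
  Σℚ λ′ ≡ 0ℚ → Σℚ (λ i → λ′ i * f i) ≡ 0ℚ →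
  (∀ i → i ≢ j → λ′ i ≡ 0ℚ ⊎ f i ≡ c) → f j - c ≢ 0ℚ → λ′ j ≡ 0ℚ
isolated-coefficient≡0 λ′ f c j Σλ≡0 Σλf≡0 others fj-c≢0 =
  p*q≡0⇒p≡0 (λ′ j) (f j - c) fj-c≢0 (begin
    λ′ j * (f j - c)                   ≡⟨ Σℚ-single g j g-others ⟨
    Σℚ g                               ≡⟨ Σℚ-affine λ′ f c ⟩
    Σℚ (λ i → λ′ i * f i) - Σℚ λ′ * c  ≡⟨ cong₂ (λ s t → s - t * c) Σλf≡0 Σλ≡0 ⟩
    0ℚ - 0ℚ * c                        ≡⟨ cong (0ℚ -_) (*-zeroˡ c) ⟩
    0ℚ                                 ∎)
  where
  open ≡-Reasoning
  g : Fin _ → ℚ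
  g i = λ′ i * (f i - c)
  g-others : ∀ i → i ≢ j → g i ≡ 0ℚ
  g-others i i≢j with others i i≢j
  ... | inj₁ λi≡0 = trans (cong (_* (f i - c)) λi≡0) (*-zeroˡ (f i - c))
  ... | inj₂ fi≡c = trans (cong (λ t → λ′ i * (t - c)) fi≡c)
                          (trans (cong (λ′ i *_) (+-inverseʳ c)) (*-zeroʳ (λ′ i)))

r≡1⇒r≢0 : ∀ {r} → r ≡ 1ℚ → r ≢ 0ℚ
r≡1⇒r≢0 refl ()

r≡0⇒r-1≢0 : ∀ {r} → r ≡ 0ℚ → r - 1ℚ ≢ 0ℚ
r≡0⇒r-1≢0 refl ()

length-filter+length-filter-¬ : ∀ {A : Set} {P : A → Set} (P? : ∀ x → Dec (P x)) xs →
  length (filter P? xs) ℕ.+ length (filter (λ x → ¬? (P? x)) xs) ≡ length xs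
length-filter+length-filter-¬ P? [] = refl
length-filter+length-filter-¬ P? (x ∷ xs) with P? x
... | yes _ = cong suc (length-filter+length-filter-¬ P? xs)
... | no  _ = trans (ℕ.+-suc _ _) (cong suc (length-filter+length-filter-¬ P? xs))

lookup-injective : ∀ {A : Set} (xs : List A) → Unique xs → Injective _≡_ _≡_ (lookup xs)
lookup-injective (x ∷ xs) u            {zero}  {zero}  eq = refl
lookup-injective (x ∷ xs) (x∉xs ∷ u)  {zero}  {suc j} eq = ⊥-elim (All.lookup x∉xs (∈-lookup j) eq)
lookup-injective (x ∷ xs) (x∉xs ∷ u)  {suc i} {zero}  eq = ⊥-elim (All.lookup x∉xs (∈-lookup i) (sym eq))
lookup-injective (x ∷ xs) (_ ∷ u)     {suc i} {suc j} eq = cong suc (lookup-injective xs u eq)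

module Construction {n : ℕ} (Adj : Rel (Fin n) 0ℓ) (adj? : Decidable Adj)
  (_≺_ : Rel (Fin n) 0ℓ) (≺-sto : IsStrictTotalOrder _≡_ _≺_) (p : Fin n → ℕ) where

  open Setup Adj adj? _≺_ ≺-sto p
  open IsStrictTotalOrder ≺-sto using (irrefl)

  InNm⇒≢ : ∀ {u v} → InNm u v → u ≢ v
  InNm⇒≢ (u≺v , _) u≡v = irrefl u≡v u≺v

  InNp⇒≢ : ∀ {v u} → InNp v u → v ≢ u
  InNp⇒≢ (v≺u , _) v≡u = irrefl v≡u v≺u

  Σ[]-term : ∀ {P : Fin n → Set} (P? : ∀ u → Dec (P u)) {f : Fin n → ℚ} →
             (∀ u → 0ℚ ≤ f u) → ∀ {u} → P u → f u ≤ Σ[ P? ] f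
  Σ[]-term P? {f} 0≤f {u} Pu =
    ≤-trans (≤-reflexive (cong (λ b → if b then f u else 0ℚ) (sym (dec-true (P? u) Pu)))) (term≤Σℚ _ 0≤term u)
    where
    0≤term : ∀ w → 0ℚ ≤ (if does (P? w) then f w else 0ℚ)
    0≤term w with does (P? w)
    ... | true  = 0≤f w
    ... | false = ≤-refl

  Σ[]≤Σℚ : ∀ {P : Fin n → Set} (P? : ∀ u → Dec (P u)) {f g : Fin n → ℚ} →
           (∀ u → f u ≤ g u) → (∀ u → 0ℚ ≤ g u) → Σ[ P? ] f ≤ Σℚ g
  Σ[]≤Σℚ P? {f} {g} f≤g 0≤g = Σℚ-mono term≤g
    where
    term≤g : ∀ u → (if does (P? u) then f u else 0ℚ) ≤ g u
    term≤g u with does (P? u)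
    ... | true  = f≤g u
    ... | false = 0≤g u

  Matrix : Set
  Matrix = Fin n → Fin n → Bool

  𝟙 : Bool → ℚ
  𝟙 true  = 1ℚ
  𝟙 false = 0ℚ

  T⇒𝟙≡1 : ∀ {b} → T b → 𝟙 b ≡ 1ℚ
  T⇒𝟙≡1 {true} _ = refl

  ¬T⇒𝟙≡0 : ∀ {b} → ¬ T b → 𝟙 b ≡ 0ℚ
  ¬T⇒𝟙≡0 {true}  ¬t = ⊥-elim (¬t _)
  ¬T⇒𝟙≡0 {false} _  = refl

  0≤𝟙 : ∀ b → 0ℚ ≤ 𝟙 b
  0≤𝟙 true  = nonNegative⁻¹ 1ℚ
  0≤𝟙 false = ≤-refl

  pointAt : ℚ → Matrix → Point n
  pointAt h R = ⟨ h , (λ u v → 𝟙 (R u v)) ⟩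

  record Admissible (R : Matrix) : Set where
    field
      column-covered : ∀ v → ∃ λ u → InNmc u v × T (R u v)
      row-unique     : ∀ v {a b} → v ≢ a → v ≢ b → T (R v a) → T (R v b) → a ≡ b
      row-diagonal   : ∀ v {a} → v ≢ a → T (R v a) → T (R v v)

  RowBound : ℚ → Bool → Set
  RowBound s d = s ≡ 0ℚ ⊎ (s ≡ 1ℚ × T d)

  RowBound⇒≤𝟙 : ∀ {s d} → RowBound s d → s ≤ 𝟙 d
  RowBound⇒≤𝟙 {d = d} (inj₁ refl)       = 0≤𝟙 d
  RowBound⇒≤𝟙         (inj₂ (refl , t)) = ≤-reflexive (sym (T⇒𝟙≡1 t))

  RowBound⇒≤1 : ∀ {s d} → RowBound s d → s ≤ 1ℚ
  RowBound⇒≤1 (inj₁ refl)       = nonNegative⁻¹ 1ℚ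
  RowBound⇒≤1 (inj₂ (refl , _)) = ≤-refl

  module _ {R : Matrix} (adm : Admissible R) where
    open Admissible adm

    𝒦-rowBound : ∀ {v K} → 𝒦 v K → RowBound (sumℚ (map (λ u → 𝟙 (R v u)) K)) (R v v)
    𝒦-rowBound {v} (pair a b v⁺a v⁺b a≢b _) =
      pairBound (R v a) (R v b)
        (λ ta tb → a≢b (row-unique v (InNp⇒≢ v⁺a) (InNp⇒≢ v⁺b) ta tb))
        (row-diagonal v (InNp⇒≢ v⁺a)) (row-diagonal v (InNp⇒≢ v⁺b))
      where
      pairBound : ∀ {d} x y → (T x → T y → ⊥) → (T x → T d) → (T y → T d) →
                  RowBound (𝟙 x + (𝟙 y + 0ℚ)) d
      pairBound true  true  excl _  _  = ⊥-elim (excl _ _)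
      pairBound true  false _    dx _  = inj₂ (refl , dx _)
      pairBound false true  _    _  dy = inj₂ (refl , dy _)
      pairBound false false _    _  _  = inj₁ refl
    𝒦-rowBound {v} (single a v⁺a _) = singleBound (R v a) (row-diagonal v (InNp⇒≢ v⁺a))
      where
      singleBound : ∀ {d} x → (T x → T d) → RowBound (𝟙 x + 0ℚ) d
      singleBound true  dx = inj₂ (refl , dx _)
      singleBound false _  = inj₁ refl

    column-sum≥1 : ∀ v → 1ℚ ≤ Σ[ (λ u → inNmc? u v) ] (λ u → 𝟙 (R u v))
    column-sum≥1 v with column-covered v
    ... | u , u∈N̄⁻[v] , t =
      ≤-trans (≤-reflexive (sym (T⇒𝟙≡1 t))) (Σ[]-term (λ w → inNmc? w v) (λ w → 0≤𝟙 (R w v)) u∈N̄⁻[v])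

  Σp : ℚ
  Σp = Σℚ (λ u → ℕ→ℚ (p u))

  0≤ℕ→ℚ : ∀ k → 0ℚ ≤ ℕ→ℚ k
  0≤ℕ→ℚ k = nonNegative⁻¹ _ {{normalize-nonNeg k 1}}

  0≤Σp : 0ℚ ≤ Σp
  0≤Σp = Σℚ-nonneg (λ u → 0≤ℕ→ℚ (p u))

  p≤Σp : ∀ v → ℕ→ℚ (p v) ≤ Σp
  p≤Σp = term≤Σℚ _ (λ u → 0≤ℕ→ℚ (p u))

  k*𝟙≤k : ∀ k b → ℕ→ℚ k * 𝟙 b ≤ ℕ→ℚ k
  k*𝟙≤k k true  = ≤-reflexive (*-identityʳ (ℕ→ℚ k))
  k*𝟙≤k k false = ≤-trans (≤-reflexive (*-zeroʳ (ℕ→ℚ k))) (0≤ℕ→ℚ k)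

  row-weight≤Σp : ∀ (R : Matrix) v → Σ[ inNp? v ] (λ u → ℕ→ℚ (p u) * 𝟙 (R v u)) ≤ Σp
  row-weight≤Σp R v = Σ[]≤Σℚ (inNp? v) (λ u → k*𝟙≤k (p u) (R v u)) (λ u → 0≤ℕ→ℚ (p u))

  M : ℚ
  M = Σp + Σp

  admissible⇒feasible : ∀ {R} → Admissible R → ∀ {c} → 0ℚ ≤ c → Feasible (pointAt (M + c) R)
  admissible⇒feasible {R} adm {c} 0≤c = record
    { y≥0    = ≤-trans (≤-trans 0≤Σp (p≤p+q 0≤Σp)) (p≤p+q 0≤c)
    ; binary = λ u v _ → binary (R u v)
    ; C1     = λ v _ → column-sum≥1 adm v
    ; C2     = λ v _ _ _ K∈𝒦 → RowBound⇒≤𝟙 (𝒦-rowBound adm K∈𝒦)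
    ; C3     = λ v _ _ _ K∈𝒦 → RowBound⇒≤1 (𝒦-rowBound adm K∈𝒦)
    ; C4     = λ v _ → ≤-trans (+-mono-≤ (≤-trans (k*𝟙≤k (p v) (R v v)) (p≤Σp v)) (row-weight≤Σp R v))
                                (p≤p+q 0≤c)
    ; C5     = λ v _ → ≤-trans (+-mono-≤ (p≤Σp v) (row-weight≤Σp R v)) (p≤p+q 0≤c)
    }
    where
    binary : ∀ b → 𝟙 b ≡ 0ℚ ⊎ 𝟙 b ≡ 1ℚ
    binary true  = inj₂ refl
    binary false = inj₁ refl

  feasible⇒In𝒫 : ∀ {q} → Feasible q → In𝒫 q
  feasible⇒In𝒫 {q} fq = 1 , (λ _ → q) , (λ _ → 1ℚ) , (λ _ → fq) , (λ _ → nonNegative⁻¹ 1ℚ) , refl ,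
                         sym (one-point (y q)) , (λ u v _ → sym (one-point (x q u v)))
    where
    one-point : ∀ r → 1ℚ * r + 0ℚ ≡ r
    one-point r = trans (+-identityʳ _) (*-identityˡ r)

  _==_ : Fin n → Fin n → Bool
  u == v = does (u ≟ᶠ v)

  T-==⇒≡ : ∀ {u v} → T (u == v) → u ≡ v
  T-==⇒≡ {u} {v} t with u ≟ᶠ v
  ... | yes u≡v = u≡v

  identity : Matrix
  identity u v = u == v

  withEntry : Fin n → Fin n → Matrix
  withEntry a b u v = (u == v) ∨ ((u == a) ∧ (v == b))

  moveDiagonal : Fin n → Fin n → Matrix
  moveDiagonal a b u v = ((u == v) ∧ not (v == b)) ∨ ((u == a) ∧ (v == b))

  identity-diagonal : ∀ v → T (identity v v)
  identity-diagonal v with v ≟ᶠ v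
  ... | yes _   = _
  ... | no  v≢v = ⊥-elim (v≢v refl)

  withEntry-diagonal : ∀ a b v → T (withEntry a b v v)
  withEntry-diagonal a b v with v ≟ᶠ v
  ... | yes _   = _
  ... | no  v≢v = ⊥-elim (v≢v refl)

  withEntry-entry : ∀ a b → T (withEntry a b a b)
  withEntry-entry a b with a ≟ᶠ b | a ≟ᶠ a | b ≟ᶠ b
  ... | yes _ | _       | _       = _
  ... | no  _ | yes _   | yes _   = _
  ... | no  _ | no  a≢a | _       = ⊥-elim (a≢a refl)
  ... | no  _ | yes _   | no  b≢b = ⊥-elim (b≢b refl)

  withEntry-support : ∀ a b {u v} → u ≢ v → T (withEntry a b u v) → u ≡ a × v ≡ b
  withEntry-support a b {u} {v} u≢v t with u ≟ᶠ v | u ≟ᶠ a | v ≟ᶠ b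
  ... | yes u≡v | _       | _       = ⊥-elim (u≢v u≡v)
  ... | no  _   | yes u≡a | yes v≡b = u≡a , v≡b
  ... | no  _   | yes _   | no  _   = ⊥-elim t
  ... | no  _   | no  _   | _       = ⊥-elim t

  moveDiagonal-diagonal : ∀ a b {v} → v ≢ b → T (moveDiagonal a b v v)
  moveDiagonal-diagonal a b {v} v≢b with v ≟ᶠ v | v ≟ᶠ b
  ... | yes _   | no  _   = _
  ... | yes _   | yes v≡b = ⊥-elim (v≢b v≡b)
  ... | no  v≢v | _       = ⊥-elim (v≢v refl)

  moveDiagonal-vacated : ∀ {a b} → a ≢ b → ¬ T (moveDiagonal a b b b)
  moveDiagonal-vacated {a} {b} a≢b t with b ≟ᶠ b | b ≟ᶠ a
  ... | yes _   | no  _   = t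
  ... | yes _   | yes b≡a = ⊥-elim (a≢b (sym b≡a))
  ... | no  b≢b | _       = ⊥-elim (b≢b refl)

  moveDiagonal-entry : ∀ {a b} → a ≢ b → T (moveDiagonal a b a b)
  moveDiagonal-entry {a} {b} a≢b with a ≟ᶠ b | a ≟ᶠ a | b ≟ᶠ b
  ... | yes a≡b | _       | _       = ⊥-elim (a≢b a≡b)
  ... | no  _   | yes _   | yes _   = _
  ... | no  _   | no  a≢a | _       = ⊥-elim (a≢a refl)
  ... | no  _   | yes _   | no  b≢b = ⊥-elim (b≢b refl)

  moveDiagonal-support : ∀ a b {u v} → u ≢ v → T (moveDiagonal a b u v) → u ≡ a × v ≡ b
  moveDiagonal-support a b {u} {v} u≢v t with u ≟ᶠ v | u ≟ᶠ a | v ≟ᶠ b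
  ... | yes u≡v | _       | _       = ⊥-elim (u≢v u≡v)
  ... | no  _   | yes u≡a | yes v≡b = u≡a , v≡b
  ... | no  _   | yes _   | no  _   = ⊥-elim t
  ... | no  _   | no  _   | _       = ⊥-elim t

  support⇒row-unique : ∀ {R : Matrix} {a b} → (∀ {u v} → u ≢ v → T (R u v) → u ≡ a × v ≡ b) →
                       ∀ v {a′ b′} → v ≢ a′ → v ≢ b′ → T (R v a′) → T (R v b′) → a′ ≡ b′
  support⇒row-unique support v v≢a′ v≢b′ ta′ tb′ =
    trans (proj₂ (support v≢a′ ta′)) (sym (proj₂ (support v≢b′ tb′)))

  identity-admissible : Admissible identity
  identity-admissible = record
    { column-covered = λ v → v , inj₁ refl , identity-diagonal v
    ; row-unique     = λ v v≢a _ t _ → ⊥-elim (v≢a (T-==⇒≡ t))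
    ; row-diagonal   = λ v _ _ → identity-diagonal v
    }

  withEntry-admissible : ∀ a b → Admissible (withEntry a b)
  withEntry-admissible a b = record
    { column-covered = λ v → v , inj₁ refl , withEntry-diagonal a b v
    ; row-unique     = support⇒row-unique (withEntry-support a b)
    ; row-diagonal   = λ v _ _ → withEntry-diagonal a b v
    }

  moveDiagonal-admissible : ∀ {a b} → InNm a b → Admissible (moveDiagonal a b)
  moveDiagonal-admissible {a} {b} a∈N̄⁻b = record
    { column-covered = λ v → covered v (v ≟ᶠ b)
    ; row-unique     = support⇒row-unique (moveDiagonal-support a b)
    ; row-diagonal   = λ v v≢a′ t →
        moveDiagonal-diagonal a b (λ v≡b → InNm⇒≢ a∈N̄⁻b (trans (sym (proj₁ (moveDiagonal-support a b v≢a′ t))) v≡b))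
    }
    where
    covered : ∀ v → Dec (v ≡ b) → ∃ λ u → InNmc u v × T (moveDiagonal a b u v)
    covered v (yes refl) = a , inj₂ a∈N̄⁻b , moveDiagonal-entry (InNm⇒≢ a∈N̄⁻b)
    covered v (no v≢b)   = v , inj₁ refl , moveDiagonal-diagonal a b v≢b

  cover : Fin n → Fin n
  cover b with any? (λ u → inNm? u b)
  ... | yes (u , _) = u
  ... | no  _       = b

  cover-InNm : ∀ {b} → ¬ InS b → InNm (cover b) b
  cover-InNm {b} b∉S with any? (λ u → inNm? u b)
  ... | yes (_ , u∈N̄⁻b) = u∈N̄⁻b
  ... | no  b∈S        = ⊥-elim (b∉S b∈S)

  Var-diagonal⇒∉S : ∀ {v} → Var v v → ¬ InS v
  Var-diagonal⇒∉S = [ proj₂ , (λ v∈N̄⁻v → ⊥-elim (InNm⇒≢ v∈N̄⁻v refl)) ]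

  pairMatrix : Fin n × Fin n → Matrix
  pairMatrix (a , b) with a ≟ᶠ b
  ... | yes _ = moveDiagonal (cover b) b
  ... | no  _ = withEntry a b

  pairMatrix-admissible : ∀ q → Var (proj₁ q) (proj₂ q) → Admissible (pairMatrix q)
  pairMatrix-admissible (a , b) var with a ≟ᶠ b
  ... | yes refl = moveDiagonal-admissible (cover-InNm (Var-diagonal⇒∉S var))
  ... | no  _    = withEntry-admissible a b

  pairMatrix-diagonal : ∀ q {v} → q ≢ (v , v) → T (pairMatrix q v v)
  pairMatrix-diagonal (a , b) {v} q≢vv with a ≟ᶠ b
  ... | yes refl = moveDiagonal-diagonal (cover a) a {v} (λ { refl → q≢vv refl })
  ... | no  _    = withEntry-diagonal a b v

  pairMatrix-vacated : ∀ {v} → ¬ InS v → ¬ T (pairMatrix (v , v) v v)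
  pairMatrix-vacated {v} v∉S with v ≟ᶠ v
  ... | yes _   = moveDiagonal-vacated (InNm⇒≢ (cover-InNm v∉S))
  ... | no  v≢v = ⊥-elim (v≢v refl)

  pairMatrix-entry : ∀ {a b} → a ≢ b → T (pairMatrix (a , b) a b)
  pairMatrix-entry {a} {b} a≢b with a ≟ᶠ b
  ... | yes a≡b = ⊥-elim (a≢b a≡b)
  ... | no  _   = withEntry-entry a b

  pairMatrix-offDiagonal : ∀ q {a b} → a ≢ b → q ≢ (a , b) →
                           proj₁ q ≡ proj₂ q ⊎ ¬ T (pairMatrix q a b)
  pairMatrix-offDiagonal (a′ , b′) a≢b q≢ab with a′ ≟ᶠ b′
  ... | yes a′≡b′ = inj₁ a′≡b′
  ... | no  _     = inj₂ λ t → let (a≡a′ , b≡b′) = withEntry-support a′ b′ a≢b t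
                               in q≢ab (cong₂ _,_ (sym a≡a′) (sym b≡b′))

  IndependentPointsIn𝒫 : ℕ → Set
  IndependentPointsIn𝒫 k = Σ (Fin k → Point n) λ pts → (∀ i → In𝒫 (pts i)) × AffinelyIndependent pts

  module Family {N : ℕ} (e : Fin N → Fin n × Fin n) (e-injective : Injective _≡_ _≡_ e)
                (e-Var : ∀ k → Var (proj₁ (e k)) (proj₂ (e k))) where

    matrix : Fin (suc (suc N)) → Matrix
    matrix zero          = identity
    matrix (suc zero)    = identity
    matrix (suc (suc k)) = pairMatrix (e k)

    height : Fin (suc (suc N)) → ℚ
    height zero          = 0ℚ
    height (suc zero)    = 1ℚ
    height (suc (suc k)) = 0ℚ

    points : Fin (suc (suc N)) → Point n
    points i = pointAt (M + height i) (matrix i)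

    points-In𝒫 : ∀ i → In𝒫 (points i)
    points-In𝒫 zero          = feasible⇒In𝒫 (admissible⇒feasible identity-admissible ≤-refl)
    points-In𝒫 (suc zero)    = feasible⇒In𝒫 (admissible⇒feasible identity-admissible (nonNegative⁻¹ 1ℚ))
    points-In𝒫 (suc (suc k)) = feasible⇒In𝒫 (admissible⇒feasible (pairMatrix-admissible (e k) (e-Var k)) ≤-refl)

    pointIndex : Fin N → Fin (suc (suc N))
    pointIndex k = suc (suc k)

    same-pair⇒same-point : ∀ {k k′} → e k′ ≡ e k → pointIndex k′ ≡ pointIndex k
    same-pair⇒same-point ek′≡ek = cong pointIndex (e-injective ek′≡ek)

    module Coefficients (λ′ : Fin (suc (suc N)) → ℚ) (Σλ≡0 : Σℚ λ′ ≡ 0ℚ)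
      (Σλy≡0 : Σℚ (λ i → λ′ i * y (points i)) ≡ 0ℚ)
      (Σλx≡0 : ∀ u v → Var u v → Σℚ (λ i → λ′ i * x (points i) u v) ≡ 0ℚ) where

      lifted≡0 : λ′ (suc zero) ≡ 0ℚ
      lifted≡0 = isolated-coefficient≡0 λ′ (λ i → M + height i) M (suc zero) Σλ≡0 Σλy≡0 others
                   (r≡1⇒r≢0 (solve 1 (λ m → (m :+ con 1ℚ) :- m := con 1ℚ) refl M))
        where
        open +-*-Solver
        others : ∀ i → i ≢ suc zero → λ′ i ≡ 0ℚ ⊎ M + height i ≡ M
        others zero          _   = inj₂ (+-identityʳ M)
        others (suc zero)    i≢1 = ⊥-elim (i≢1 refl)
        others (suc (suc _)) _   = inj₂ (+-identityʳ M)

      diagonal≡0 : ∀ k {v} → e k ≡ (v , v) → λ′ (pointIndex k) ≡ 0ℚ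
      diagonal≡0 k {v} ek≡vv =
        isolated-coefficient≡0 λ′ (λ i → 𝟙 (matrix i v v)) 1ℚ (pointIndex k) Σλ≡0 (Σλx≡0 v v var) others
          (r≡0⇒r-1≢0 (trans (cong (λ q → 𝟙 (pairMatrix q v v)) ek≡vv)
                            (¬T⇒𝟙≡0 (pairMatrix-vacated (Var-diagonal⇒∉S var)))))
        where
        var : Var v v
        var = subst (λ q → Var (proj₁ q) (proj₂ q)) ek≡vv (e-Var k)
        others : ∀ i → i ≢ pointIndex k → λ′ i ≡ 0ℚ ⊎ 𝟙 (matrix i v v) ≡ 1ℚ
        others zero           _ = inj₂ (T⇒𝟙≡1 (identity-diagonal v))
        others (suc zero)     _ = inj₂ (T⇒𝟙≡1 (identity-diagonal v))
        others (suc (suc k′)) i≢j = inj₂ (T⇒𝟙≡1 (pairMatrix-diagonal (e k′) λ ek′≡vv →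
                                       i≢j (same-pair⇒same-point (trans ek′≡vv (sym ek≡vv)))))

      offDiagonal≡0 : ∀ k {a b} → e k ≡ (a , b) → a ≢ b → λ′ (pointIndex k) ≡ 0ℚ
      offDiagonal≡0 k {a} {b} ek≡ab a≢b =
        isolated-coefficient≡0 λ′ (λ i → 𝟙 (matrix i a b)) 0ℚ (pointIndex k) Σλ≡0 (Σλx≡0 a b var) others
          (r≡1⇒r≢0 (trans (+-identityʳ _) (trans (cong (λ q → 𝟙 (pairMatrix q a b)) ek≡ab)
                                                 (T⇒𝟙≡1 (pairMatrix-entry a≢b)))))
        where
        var : Var a b
        var = subst (λ q → Var (proj₁ q) (proj₂ q)) ek≡ab (e-Var k)
        identity-off : 𝟙 (identity a b) ≡ 0ℚ
        identity-off = ¬T⇒𝟙≡0 (a≢b ∘′ T-==⇒≡)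
        others : ∀ i → i ≢ pointIndex k → λ′ i ≡ 0ℚ ⊎ 𝟙 (matrix i a b) ≡ 0ℚ
        others zero           _   = inj₂ identity-off
        others (suc zero)     _   = inj₂ identity-off
        others (suc (suc k′)) i≢j with pairMatrix-offDiagonal (e k′) a≢b
                                         (λ ek′≡ab → i≢j (same-pair⇒same-point (trans ek′≡ab (sym ek≡ab))))
        ... | inj₁ diagonal = inj₁ (diagonal≡0 k′ (cong (_, proj₂ (e k′)) diagonal))
        ... | inj₂ ¬t       = inj₂ (¬T⇒𝟙≡0 ¬t)

      variable≡0 : ∀ k → λ′ (pointIndex k) ≡ 0ℚ
      variable≡0 k with proj₁ (e k) ≟ᶠ proj₂ (e k)
      ... | yes a≡b = diagonal≡0 k (cong (_, proj₂ (e k)) a≡b)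
      ... | no  a≢b = offDiagonal≡0 k refl a≢b

      coefficient≡0 : ∀ i → λ′ i ≡ 0ℚ
      coefficient≡0 zero          = trans (sym (Σℚ-single λ′ zero nonzero≡0)) Σλ≡0
        where
        nonzero≡0 : ∀ i → i ≢ zero → λ′ i ≡ 0ℚ
        nonzero≡0 zero          i≢0 = ⊥-elim (i≢0 refl)
        nonzero≡0 (suc zero)    _   = lifted≡0
        nonzero≡0 (suc (suc k)) _   = variable≡0 k
      coefficient≡0 (suc zero)    = lifted≡0
      coefficient≡0 (suc (suc k)) = variable≡0 k

    independentPoints : IndependentPointsIn𝒫 (suc (suc N))
    independentPoints = points , points-In𝒫 , Coefficients.coefficient≡0

  diagonalVariables : List (Fin n × Fin n)
  diagonalVariables = map (λ v → v , v) (filter (λ v → ¬? (inS? v)) (allFin n))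

  columnVariables : Fin n → List (Fin n × Fin n)
  columnVariables v = map (_, v) (filter (λ u → inNm? u v) (allFin n))

  offDiagonalVariables : List (Fin n × Fin n)
  offDiagonalVariables = concat (map columnVariables (allFin n))

  variables : List (Fin n × Fin n)
  variables = diagonalVariables ++ offDiagonalVariables

  length-diagonalVariables : length diagonalVariables ≡ n ℕ.∸ cardS
  length-diagonalVariables = begin
    length diagonalVariables                          ≡⟨ length-map _ (filter (λ v → ¬? (inS? v)) (allFin n)) ⟩
    d                                                 ≡⟨ ℕ.m+n∸m≡n cardS d ⟨
    (cardS ℕ.+ d) ℕ.∸ cardS                           ≡⟨ cong (ℕ._∸ cardS) (length-filter+length-filter-¬ inS? (allFin n)) ⟩
    length (allFin n) ℕ.∸ cardS                       ≡⟨ cong (ℕ._∸ cardS) (length-tabulate (λ i → i)) ⟩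
    n ℕ.∸ cardS                                       ∎
    where
    open ≡-Reasoning
    d = length (filter (λ v → ¬? (inS? v)) (allFin n))

  length-offDiagonalVariables : ∀ vs → length (concat (map columnVariables vs)) ≡
                                foldr ℕ._+_ 0 (map (λ v → count (λ u → inNm? u v)) vs)
  length-offDiagonalVariables []       = refl
  length-offDiagonalVariables (v ∷ vs) =
    trans (length-++ (columnVariables v))
          (cong₂ ℕ._+_ (length-map _ (filter (λ u → inNm? u v) (allFin n))) (length-offDiagonalVariables vs))

  length-variables : length variables ≡ nvars
  length-variables = begin
    length variables                                   ≡⟨ length-++ diagonalVariables ⟩
    length diagonalVariables ℕ.+ length offDiagonalVariables
      ≡⟨ cong₂ ℕ._+_ length-diagonalVariables (length-offDiagonalVariables (allFin n)) ⟩
    (n ℕ.∸ cardS) ℕ.+ ebar                             ≡⟨ ℕ.+-∸-comm ebar cardS≤n ⟨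
    nvars                                              ∎
    where
    open ≡-Reasoning
    cardS≤n : cardS ℕ.≤ n
    cardS≤n = ℕ.≤-trans (length-filter inS? (allFin n)) (ℕ.≤-reflexive (length-tabulate (λ i → i)))

  ∈diagonalVariables : ∀ {q} → q ∈ diagonalVariables → proj₁ q ≡ proj₂ q × ¬ InS (proj₂ q)
  ∈diagonalVariables q∈ with ∈-map⁻ (λ v → v , v) q∈
  ... | v , v∈ , refl = refl , proj₂ (∈-filter⁻ (λ v → ¬? (inS? v)) {xs = allFin n} v∈)

  ∈columnVariables : ∀ {q} v → q ∈ columnVariables v → InNm (proj₁ q) v × proj₂ q ≡ v
  ∈columnVariables v q∈ with ∈-map⁻ (_, v) q∈
  ... | u , u∈ , refl = proj₂ (∈-filter⁻ (λ u → inNm? u v) {xs = allFin n} u∈) , refl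

  ∈offDiagonalVariables : ∀ {q} → q ∈ offDiagonalVariables → InNm (proj₁ q) (proj₂ q)
  ∈offDiagonalVariables q∈ with ∈-concat⁻′ (map columnVariables (allFin n)) q∈
  ... | _ , q∈col , col∈ with ∈-map⁻ columnVariables col∈
  ... | v , _ , refl with ∈columnVariables v q∈col
  ... | u∈N̄⁻v , refl = u∈N̄⁻v

  ∈variables⇒Var : ∀ {q} → q ∈ variables → Var (proj₁ q) (proj₂ q)
  ∈variables⇒Var q∈ with ∈-++⁻ diagonalVariables q∈
  ... | inj₁ q∈diag = inj₁ (∈diagonalVariables q∈diag)
  ... | inj₂ q∈off  = inj₂ (∈offDiagonalVariables q∈off)

  variables-unique : Unique variables
  variables-unique = Unique.++⁺ diagonal-unique offDiagonal-unique disjoint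
    where
    diagonal-unique : Unique diagonalVariables
    diagonal-unique = Unique.map⁺ (cong proj₁) (Unique.filter⁺ (λ v → ¬? (inS? v)) (Unique.allFin⁺ n))
    column-unique : ∀ v → Unique (columnVariables v)
    column-unique v = Unique.map⁺ (cong proj₁) (Unique.filter⁺ (λ u → inNm? u v) (Unique.allFin⁺ n))
    columns-disjoint : ∀ {v w} → v ≢ w → ∀ {q} → ¬ (q ∈ columnVariables v × q ∈ columnVariables w)
    columns-disjoint v≢w (q∈v , q∈w) =
      v≢w (trans (sym (proj₂ (∈columnVariables _ q∈v))) (proj₂ (∈columnVariables _ q∈w)))
    offDiagonal-unique : Unique offDiagonalVariables
    offDiagonal-unique =
      Unique.concat⁺ (All.map⁺ (All.universal column-unique (allFin n)))
                     (AllPairs.map⁺ (AllPairs.map (λ v≢w {q} → columns-disjoint v≢w {q}) (Unique.allFin⁺ n)))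
    disjoint : ∀ {q} → ¬ (q ∈ diagonalVariables × q ∈ offDiagonalVariables)
    disjoint (q∈diag , q∈off) = InNm⇒≢ (∈offDiagonalVariables q∈off) (proj₁ (∈diagonalVariables q∈diag))

  fullDimensional : FullDimensional
  fullDimensional = subst (λ N → IndependentPointsIn𝒫 (suc (suc N))) length-variables
    (Family.independentPoints (lookup variables) (lookup-injective variables variables-unique)
                              (λ k → ∈variables⇒Var (∈-lookup k)))

theorem1 : (n : ℕ) (Adj : Rel (Fin n) 0ℓ) (adj? : Decidable Adj)
    → Symmetric Adj → (∀ v → ¬ Adj v v)
    → (_≺_ : Rel (Fin n) 0ℓ) (≺-sto : IsStrictTotalOrder _≡_ _≺_)
    → (p : Fin n → ℕ) → (∀ v → 0 < p v)
    → Setup.FullDimensional Adj adj? _≺_ ≺-sto p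
theorem1 n Adj adj? _ _ _≺_ ≺-sto p _ = Construction.fullDimensional Adj adj? _≺_ ≺-sto p
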